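{- Let $\lambda_1, \lambda_2 \in \mathbb{N}$ be two coprime positive integers such that $\lambda_1 \equiv \lambda_2+1 \pmod{3}$, and let $S=\{0,\lambda_1,\lambda_1+\lambda_2\}$. Then \[ d_f(S)\geq d_f(S,-S) \ge \frac{\lfloor \frac{2}{3}( 2\lambda_1+\lambda_2)\rfloor}{2\lambda_1+\lambda_2}. \]
   Context: For $A\subset\mathbb{Z}$, the upper density is $\overline{d}(A)=\limsup_{n\to\infty}\frac{|A\cap[-n,n]|}{2n+1}$. For $S\subset\mathbb{Z}$, a translate of $S$ is a set $S+t=\{s+t:s\in S\}$ with $t\in\mathbb{Z}$, and $-S=\{ -s:s\in S\}$. A set $A\subset\mathbb{Z}$ is $S$-free if it contains no translate of $S$. $d_f(S)$ is the supremum of $\overline{d}(A)$ over all $S$-free sets $A\subset\mathbb{Z}$, and $d_f(S,-S)$ is the supremum of $\overline{d}(A)$ over all sets $A\subset\mathbb{Z}$ that contain no translate of $S$ and no translate of $-S$. -}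

module Defs where

open import Data.Bool using (Bool; true)
open import Data.Nat as ℕ using (ℕ; zero; suc)
open import Data.Integer as ℤ using (ℤ; +_)
open import Data.Rational as ℚ using (ℚ; 0ℚ; _<_)
open import Data.List using (List; []; _∷_; map; filter; length)
open import Data.List.Relation.Unary.All using (All)
open import Data.Product using (Σ; _×_; ∃-syntax)
open import Relation.Binary.PropositionalEquality using (_≡_)
open import Relation.Nullary using (¬_)
open import Data.Bool using (T)

SetZ : Set
SetZ = ℤ → Bool

interval : ℕ → List ℤ
interval zero = + 0 ∷ []
interval (suc n) = ℤ.- (+ suc n) ∷ + suc n ∷ interval n

count : SetZ → ℕ → ℕ
count A n = length (filter (λ k → T? (A k)) (interval n))
  where open import Data.Bool.Properties using (T?)

ratioAt : SetZ → ℕ → ℚ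
ratioAt A n = (+ count A n) ℚ./ suc (2 ℕ.* n)

-- a / b as a rational (b > 0 in all uses; 0 if b = 0)
frac : ℕ → ℕ → ℚ
frac a zero = 0ℚ
frac a (suc b) = (+ a) ℚ./ suc b

ContainsTranslate : SetZ → List ℤ → ℤ → Set
ContainsTranslate A S t = All (λ s → A (s ℤ.+ t) ≡ true) S

Free : List ℤ → SetZ → Set
Free S A = ∀ t → ¬ ContainsTranslate A S t

negS : List ℤ → List ℤ
negS = map (λ s → ℤ.- s)

FreeBoth : List ℤ → SetZ → Set
FreeBoth S A = Free S A × Free (negS S) A

-- upper density of A is ≥ r  (limsup_n ratioAt A n ≥ r):
-- for every ε > 0 and every N there is n ≥ N with ratioAt A n > r - ε
UpperDensityAtLeast : SetZ → ℚ → Set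
UpperDensityAtLeast A r =
  ∀ (ε : ℚ) → 0ℚ < ε → ∀ (N : ℕ) → ∃[ n ] (N ℕ.≤ n × (r ℚ.- ε) < ratioAt A n)

-- sup { d̄(A) : P A } ≥ r :
-- for every ε > 0 there is A with P A and d̄(A) ≥ r - ε
SupDensityAtLeast : (SetZ → Set) → ℚ → Set
SupDensityAtLeast P r =
  ∀ (ε : ℚ) → 0ℚ < ε → ∃[ A ] (P A × UpperDensityAtLeast A (r ℚ.- ε))

DfAtLeast : List ℤ → ℚ → Set
DfAtLeast S = SupDensityAtLeast (Free S)

DfBothAtLeast : List ℤ → ℚ → Set
DfBothAtLeast S = SupDensityAtLeast (FreeBoth S)

-- d_f(S) ≥ d_f(S,-S), expressed as: every rational lower bound of d_f(S,-S)
-- is a lower bound of d_f(S)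
DfGeDfBoth : List ℤ → Set
DfGeDfBoth S = ∀ (r : ℚ) → DfBothAtLeast S r → DfAtLeast S r

{-# OPTIONS --safe #-}
-- Let m = 2λ₁ + λ₂ (so m ≡ 2 mod 3) and let u invert λ₁ modulo m (λ₁ is coprime to m). Call a
-- residue j allowed if j ≠ m - 1 and j ≢ 2 (mod 3): there are ⌊2m/3⌋ of them, and no three
-- cyclically consecutive residues are all allowed. Let A = {x : u x mod m is allowed}. Multiplication
-- by u sends x, x + λ₁, x + 2λ₁ to consecutive residues, and because 2λ₁ + λ₂ ≡ 0 (mod m) every
-- translate of S or of -S contains such a triple modulo m; so A avoids both. Being m-periodic with
-- ⌊2m/3⌋ elements per period, A has upper density ⌊2m/3⌋/m. Finally d_f(S) ≥ d_f(S,-S) because a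
-- set avoiding S and -S avoids S.

module Submission where

open import Defs
open import Data.Nat using (ℕ; _+_; _*_; _/_; _%_; _<_)
open import Data.Nat.Coprimality using (Coprime)
open import Data.Integer using (ℤ; +_)
open import Data.List using (List; []; _∷_)
open import Data.Product using (_×_)
open import Relation.Binary.PropositionalEquality using (_≡_)

open import Data.Bool using (Bool; true; false; not; _∧_; T)
open import Data.Bool.Properties using (T?)
open import Data.Nat using (zero; suc; pred; _∸_; _≤_; z≤n; s≤s; NonZero; _≟_; _≡ᵇ_)
open import Data.Nat.Properties
open import Data.Nat.DivMod
open import Data.Nat.Divisibility using (divides-refl; ∣-refl)
open import Data.Nat.Coprimality using (coprime-Bézout; coprime-+)
import Data.Nat.Coprimality as Coprime
open import Data.Nat.GCD using (module Bézout)
open import Data.Nat.Tactic.RingSolver using (solve)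
open import Data.Integer using (-[1+_]; -_; +≤+) renaming (_+_ to _+ℤ_; suc to sucℤ; _≤_ to _≤ℤ_)
import Data.Integer.Properties as ℤ
open import Data.Integer.Tactic.RingSolver using (solve-∀)
open import Data.Rational as ℚ using (0ℚ; fromℚᵘ)
import Data.Rational.Properties as ℚ
import Data.Rational.Unnormalised as ℚᵘ
import Data.Rational.Unnormalised.Properties as ℚᵘ
open import Data.List using (length; filter)
import Data.List.Relation.Unary.All as All
open import Data.Fin using (Fin; toℕ; fromℕ<)
import Data.Fin.Properties as Fin
open import Data.Fin.Permutation using (permutation)
open import Algebra.Properties.CommutativeSemigroup +-commutativeSemigroup using (interchange)
open import Algebra.Properties.CommutativeMonoid.Sum +-0-commutativeMonoid
  using (sum; sum-permute; sum-cong-≗)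
open import Data.Product using (∃-syntax; _,_; proj₁; proj₂)
open import Data.Sum using (_⊎_; inj₁; inj₂; [_,_])
open import Data.Empty using (⊥)
open import Function using (_∘_)
open import Relation.Nullary using (yes; no; contradiction)
open import Relation.Binary.PropositionalEquality
  using (refl; sym; trans; cong; cong₂; subst; subst₂; _≢_; module ≡-Reasoning)
open ≡-Reasoning

[m%d+n]%d≡[m+n]%d : ∀ m n d .{{_ : NonZero d}} → (m % d + n) % d ≡ (m + n) % d
[m%d+n]%d≡[m+n]%d m n d = begin
  (m % d + n) % d         ≡⟨ %-distribˡ-+ (m % d) n d ⟩
  (m % d % d + n % d) % d ≡⟨ cong (λ x → (x + n % d) % d) (m%n%n≡m%n m d) ⟩
  (m % d + n % d) % d     ≡⟨ %-distribˡ-+ m n d ⟨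
  (m + n) % d             ∎

[m+n%d]%d≡[m+n]%d : ∀ m n d .{{_ : NonZero d}} → (m + n % d) % d ≡ (m + n) % d
[m+n%d]%d≡[m+n]%d m n d = begin
  (m + n % d) % d ≡⟨ cong (_% d) (+-comm m (n % d)) ⟩
  (n % d + m) % d ≡⟨ [m%d+n]%d≡[m+n]%d n m d ⟩
  (n + m) % d     ≡⟨ cong (_% d) (+-comm n m) ⟩
  (m + n) % d     ∎

[m*[n%d]]%d≡[m*n]%d : ∀ m n d .{{_ : NonZero d}} → (m * (n % d)) % d ≡ (m * n) % d
[m*[n%d]]%d≡[m*n]%d m n d = begin
  (m * (n % d)) % d           ≡⟨ %-distribˡ-* m (n % d) d ⟩
  (m % d * (n % d % d)) % d   ≡⟨ cong (λ x → (m % d * x) % d) (m%n%n≡m%n n d) ⟩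
  (m % d * (n % d)) % d       ≡⟨ %-distribˡ-* m n d ⟨
  (m * n) % d                 ∎

%-congˡ-+ : ∀ {m n} o d .{{_ : NonZero d}} → m % d ≡ n % d → (m + o) % d ≡ (n + o) % d
%-congˡ-+ {m} {n} o d m≡n = begin
  (m + o) % d     ≡⟨ [m%d+n]%d≡[m+n]%d m o d ⟨
  (m % d + o) % d ≡⟨ cong (λ x → (x + o) % d) m≡n ⟩
  (n % d + o) % d ≡⟨ [m%d+n]%d≡[m+n]%d n o d ⟩
  (n + o) % d     ∎

*-inverse-% : ∀ {u a} i d .{{_ : NonZero d}} → (u * a) % d ≡ 1 % d →
              (u * ((a * i) % d)) % d ≡ i % d
*-inverse-% {u} {a} i d ua≡1 = begin
  (u * ((a * i) % d)) % d   ≡⟨ [m*[n%d]]%d≡[m*n]%d u (a * i) d ⟩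
  (u * (a * i)) % d         ≡⟨ cong (_% d) (*-assoc u a i) ⟨
  (u * a * i) % d           ≡⟨ %-distribˡ-* (u * a) i d ⟩
  ((u * a) % d * (i % d)) % d ≡⟨ cong (λ x → (x * (i % d)) % d) ua≡1 ⟩
  (1 % d * (i % d)) % d     ≡⟨ %-distribˡ-* 1 i d ⟨
  (1 * i) % d               ≡⟨ cong (_% d) (*-identityˡ i) ⟩
  i % d                     ∎

inverse-mod : ∀ a m′ → Coprime a (suc m′) → ∃[ u ] (u * a) % suc m′ ≡ 1 % suc m′
inverse-mod a m′ a⊥m with coprime-Bézout a⊥m
... | Bézout.+- x y 1+ym≡xa = x , (begin
  (x * a) % suc m′             ≡⟨ cong (_% suc m′) 1+ym≡xa ⟨
  (1 + y * suc m′) % suc m′    ≡⟨ [m+kn]%n≡m%n 1 y (suc m′) ⟩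
  1 % suc m′                   ∎)
-- xa ≡ -1 (mod m), so x(m - 1) inverts a.
... | Bézout.-+ x y 1+xa≡ym = x * m′ , (begin
  (x * m′ * a) % suc m′            ≡⟨ [m+n]%n≡m%n (x * m′ * a) (suc m′) ⟨
  (x * m′ * a + suc m′) % suc m′   ≡⟨ cong (_% suc m′) shifted ⟩
  (1 + y * m′ * suc m′) % suc m′   ≡⟨ [m+kn]%n≡m%n 1 (y * m′) (suc m′) ⟩
  1 % suc m′                       ∎)
  where
  shifted : x * m′ * a + suc m′ ≡ 1 + y * m′ * suc m′
  shifted = begin
    x * m′ * a + suc m′    ≡⟨ solve (x ∷ m′ ∷ a ∷ []) ⟩
    1 + (1 + x * a) * m′   ≡⟨ cong (λ z → 1 + z * m′) 1+xa≡ym ⟩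
    1 + y * suc m′ * m′    ≡⟨ solve (y ∷ m′ ∷ []) ⟩
    1 + y * m′ * suc m′    ∎

2a+b≡a+[a+b] : ∀ a b → 2 * a + b ≡ a + (a + b)
2a+b≡a+[a+b] a b = solve (a ∷ b ∷ [])

[2a+b]%3≡2 : ∀ a b → a % 3 ≡ (b + 1) % 3 → (2 * a + b) % 3 ≡ 2
[2a+b]%3≡2 a b a≡b+1 = begin
  (2 * a + b) % 3           ≡⟨ cong (_% 3) (2a+b≡a+[a+b] a b) ⟩
  (a + (a + b)) % 3         ≡⟨ %-congˡ-+ {a} {b + 1} (a + b) 3 a≡b+1 ⟩
  (b + 1 + (a + b)) % 3     ≡⟨ cong (_% 3) (b+1+[a+b]≡a+[2b+1] a b) ⟩
  (a + (2 * b + 1)) % 3     ≡⟨ %-congˡ-+ {a} {b + 1} (2 * b + 1) 3 a≡b+1 ⟩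
  (b + 1 + (2 * b + 1)) % 3 ≡⟨ cong (_% 3) (b+1+[2b+1]≡2+3b b) ⟩
  (2 + b * 3) % 3           ≡⟨ [m+kn]%n≡m%n 2 b 3 ⟩
  2                         ∎
  where
  b+1+[a+b]≡a+[2b+1] : ∀ a b → b + 1 + (a + b) ≡ a + (2 * b + 1)
  b+1+[a+b]≡a+[2b+1] a b = solve (a ∷ b ∷ [])
  b+1+[2b+1]≡2+3b : ∀ b → b + 1 + (2 * b + 1) ≡ 2 + b * 3
  b+1+[2b+1]≡2+3b b = solve (b ∷ [])

%3≡2-among-three : ∀ n → n % 3 ≡ 2 ⊎ suc n % 3 ≡ 2 ⊎ suc (suc n) % 3 ≡ 2
%3≡2-among-three 0 = inj₂ (inj₂ refl)
%3≡2-among-three 1 = inj₂ (inj₁ refl)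
%3≡2-among-three 2 = inj₁ refl
%3≡2-among-three (suc (suc (suc n))) with %3≡2-among-three n
... | inj₁ e        = inj₁ (trans (%-remove-+ˡ n {3} ∣-refl) e)
... | inj₂ (inj₁ e) = inj₂ (inj₁ (trans (%-remove-+ˡ (suc n) {3} ∣-refl) e))
... | inj₂ (inj₂ e) = inj₂ (inj₂ (trans (%-remove-+ˡ (suc (suc n)) {3} ∣-refl) e))

𝟙 : Bool → ℕ
𝟙 true  = 1
𝟙 false = 0

𝟙≤1 : ∀ b → 𝟙 b ≤ 1
𝟙≤1 true  = ≤-refl
𝟙≤1 false = z≤n

sum< : (ℕ → ℕ) → ℕ → ℕ
sum< f zero    = 0
sum< f (suc n) = f 0 + sum< (f ∘ suc) n

sum<-cong : ∀ f g n → (∀ {i} → i < n → f i ≡ g i) → sum< f n ≡ sum< g n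
sum<-cong f g zero    f≡g = refl
sum<-cong f g (suc n) f≡g =
  cong₂ _+_ (f≡g (s≤s z≤n)) (sum<-cong (f ∘ suc) (g ∘ suc) n (f≡g ∘ s≤s))

sum<-+ : ∀ f g n → sum< (λ i → f i + g i) n ≡ sum< f n + sum< g n
sum<-+ f g zero    = refl
sum<-+ f g (suc n) = begin
  f 0 + g 0 + sum< (λ i → f (suc i) + g (suc i)) n  ≡⟨ cong (_+_ (f 0 + g 0)) (sum<-+ (f ∘ suc) (g ∘ suc) n) ⟩
  f 0 + g 0 + (sum< (f ∘ suc) n + sum< (g ∘ suc) n) ≡⟨ interchange (f 0) (g 0) _ _ ⟩
  f 0 + sum< (f ∘ suc) n + (g 0 + sum< (g ∘ suc) n) ∎

sum<-snoc : ∀ f n → sum< f (suc n) ≡ sum< f n + f n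
sum<-snoc f zero    = +-comm (f 0) 0
sum<-snoc f (suc n) = begin
  f 0 + sum< (f ∘ suc) (suc n)       ≡⟨ cong (_+_ (f 0)) (sum<-snoc (f ∘ suc) n) ⟩
  f 0 + (sum< (f ∘ suc) n + f (suc n)) ≡⟨ +-assoc (f 0) _ (f (suc n)) ⟨
  sum< f (suc n) + f (suc n)         ∎

sum<-split : ∀ f k n → sum< f (k + n) ≡ sum< f k + sum< (λ i → f (k + i)) n
sum<-split f zero    n = refl
sum<-split f (suc k) n = begin
  f 0 + sum< (f ∘ suc) (k + n)                                 ≡⟨ cong (_+_ (f 0)) (sum<-split (f ∘ suc) k n) ⟩
  f 0 + (sum< (f ∘ suc) k + sum< (λ i → f (suc k + i)) n)     ≡⟨ +-assoc (f 0) _ _ ⟨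
  f 0 + sum< (f ∘ suc) k + sum< (λ i → f (suc k + i)) n       ∎

sum<-periodic : ∀ f n → (∀ i → f (n + i) ≡ f i) → ∀ q → sum< f (q * n) ≡ q * sum< f n
sum<-periodic f n periodic zero    = refl
sum<-periodic f n periodic (suc q) = begin
  sum< f (n + q * n)                                ≡⟨ sum<-split f n (q * n) ⟩
  sum< f n + sum< (λ i → f (n + i)) (q * n)         ≡⟨ cong (_+_ (sum< f n)) (sum<-cong _ f (q * n) (λ _ → periodic _)) ⟩
  sum< f n + sum< f (q * n)                         ≡⟨ cong (_+_ (sum< f n)) (sum<-periodic f n periodic q) ⟩
  sum< f n + q * sum< f n                           ∎

sum<-rotate : ∀ f n → f n ≡ f 0 → sum< (f ∘ suc) n ≡ sum< f n
sum<-rotate f n fn≡f0 = +-cancelˡ-≡ (f 0) _ _ (begin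
  f 0 + sum< (f ∘ suc) n ≡⟨ sum<-snoc f n ⟩
  sum< f n + f n         ≡⟨ cong (_+_ (sum< f n)) fn≡f0 ⟩
  sum< f n + f 0         ≡⟨ +-comm (sum< f n) (f 0) ⟩
  f 0 + sum< f n         ∎)

sum<-𝟙≤ : ∀ B n → sum< (𝟙 ∘ B) n ≤ n
sum<-𝟙≤ B zero    = z≤n
sum<-𝟙≤ B (suc n) = +-mono-≤ (𝟙≤1 (B 0)) (sum<-𝟙≤ (B ∘ suc) n)

sum≡sum< : ∀ f n → sum {n} (f ∘ toℕ) ≡ sum< f n
sum≡sum< f zero    = refl
sum≡sum< f (suc n) = cong (_+_ (f 0)) (sum≡sum< (f ∘ suc) n)

sum<-permute : ∀ n (σ τ : ℕ → ℕ) →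
               (∀ {i} → i < n → σ i < n) → (∀ {i} → i < n → τ i < n) →
               (∀ {i} → i < n → σ (τ i) ≡ i) → (∀ {i} → i < n → τ (σ i) ≡ i) →
               ∀ f → sum< (f ∘ σ) n ≡ sum< f n
sum<-permute n σ τ σ<n τ<n στ τσ f = begin
  sum< (f ∘ σ) n                   ≡⟨ sum≡sum< (f ∘ σ) n ⟨
  sum {n} (f ∘ σ ∘ toℕ)            ≡⟨ sum-cong-≗ (λ i → cong f (sym (Fin.toℕ-fromℕ< (σ<n (Fin.toℕ<n i))))) ⟩
  sum {n} (f ∘ toℕ ∘ σ′)           ≡⟨ sum-permute (f ∘ toℕ) π ⟨
  sum {n} (f ∘ toℕ)                ≡⟨ sum≡sum< f n ⟩
  sum< f n                         ∎
  where
  σ′ τ′ : Fin n → Fin n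
  σ′ i = fromℕ< (σ<n (Fin.toℕ<n i))
  τ′ i = fromℕ< (τ<n (Fin.toℕ<n i))
  inverse : ∀ {ρ ρ′ : ℕ → ℕ} (ρ<n : ∀ {i} → i < n → ρ i < n) (ρ′<n : ∀ {i} → i < n → ρ′ i < n) →
            (∀ {i} → i < n → ρ (ρ′ i) ≡ i) → ∀ i →
            fromℕ< (ρ<n (Fin.toℕ<n (fromℕ< (ρ′<n (Fin.toℕ<n i))))) ≡ i
  inverse {ρ} {ρ′} ρ<n ρ′<n ρρ′ i = Fin.toℕ-injective (begin
    toℕ (fromℕ< (ρ<n (Fin.toℕ<n (fromℕ< (ρ′<n (Fin.toℕ<n i)))))) ≡⟨ Fin.toℕ-fromℕ< _ ⟩
    ρ (toℕ (fromℕ< (ρ′<n (Fin.toℕ<n i))))                        ≡⟨ cong ρ (Fin.toℕ-fromℕ< _) ⟩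
    ρ (ρ′ (toℕ i))                                              ≡⟨ ρρ′ (Fin.toℕ<n i) ⟩
    toℕ i                                                       ∎)
  π = permutation σ′ τ′ (inverse σ<n τ<n στ) (inverse τ<n σ<n τσ)

sum<-reverse : ∀ f n → sum< (λ i → f (n ∸ i)) (suc n) ≡ sum< f (suc n)
sum<-reverse f n = sum<-permute (suc n) (n ∸_) (n ∸_) n∸i<1+n n∸i<1+n
  n∸[n∸i]≡i n∸[n∸i]≡i f
  where
  n∸i<1+n : ∀ {i} → i < suc n → n ∸ i < suc n
  n∸i<1+n {i} _ = s≤s (m∸n≤m n i)
  n∸[n∸i]≡i : ∀ {i} → i < suc n → n ∸ (n ∸ i) ≡ i
  n∸[n∸i]≡i (s≤s i≤n) = m∸[m∸n]≡n i≤n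

length-filter-∷ : ∀ {X : Set} (P : X → Bool) x xs →
                  length (filter (λ y → T? (P y)) (x ∷ xs)) ≡ 𝟙 (P x) + length (filter (λ y → T? (P y)) xs)
length-filter-∷ P x xs with P x
... | true  = refl
... | false = refl

count≡sum< : ∀ A n → count A n ≡ sum< (λ i → 𝟙 (A -[1+ i ]) + 𝟙 (A (+ suc i))) n + 𝟙 (A (+ 0))
count≡sum< A zero    = trans (length-filter-∷ A (+ 0) []) (+-identityʳ _)
count≡sum< A (suc n) = begin
  count A (suc n)                                 ≡⟨ trans (length-filter-∷ A _ _)
                                                         (cong (_+_ _) (length-filter-∷ A _ _)) ⟩
  𝟙 (A -[1+ n ]) + (𝟙 (A (+ suc n)) + count A n)  ≡⟨ +-assoc (𝟙 (A -[1+ n ])) _ _ ⟨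
  h n + count A n                                 ≡⟨ cong (_+_ (h n)) (count≡sum< A n) ⟩
  h n + (sum< h n + 𝟙 (A (+ 0)))                  ≡⟨ +-assoc (h n) _ _ ⟨
  h n + sum< h n + 𝟙 (A (+ 0))                    ≡⟨ cong (_+ 𝟙 (A (+ 0))) (+-comm (h n) _) ⟩
  sum< h n + h n + 𝟙 (A (+ 0))                    ≡⟨ cong (_+ 𝟙 (A (+ 0))) (sum<-snoc h n) ⟨
  sum< h (suc n) + 𝟙 (A (+ 0))                    ∎
  where
  h : ℕ → ℕ
  h i = 𝟙 (A -[1+ i ]) + 𝟙 (A (+ suc i))

p-q<p : ∀ p {q} → 0ℚ ℚ.< q → p ℚ.- q ℚ.< p
p-q<p p 0<q = subst (p ℚ.- _ ℚ.<_) (ℚ.+-identityʳ p) (ℚ.+-monoʳ-< p (ℚ.neg-antimono-< 0<q))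

fromℚᵘ-mono-≤ : ∀ {p q} → p ℚᵘ.≤ q → fromℚᵘ p ℚ.≤ fromℚᵘ q
fromℚᵘ-mono-≤ {p} {q} p≤q = ℚ.toℚᵘ-cancel-≤
  (ℚᵘ.≤-respʳ-≃ (ℚᵘ.≃-sym (ℚ.toℚᵘ-fromℚᵘ q)) (ℚᵘ.≤-respˡ-≃ (ℚᵘ.≃-sym (ℚ.toℚᵘ-fromℚᵘ p)) p≤q))

frac≤ratioAt : ∀ g d A n → g * suc (2 * n) ≤ count A n * suc d → frac g (suc d) ℚ.≤ ratioAt A n
frac≤ratioAt g d A n g[2n+1]≤c[d+1] =
  fromℚᵘ-mono-≤ {ℚᵘ.mkℚᵘ (+ g) d} {ℚᵘ.mkℚᵘ (+ count A n) (2 * n)}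
    (ℚᵘ.*≤* (subst₂ _≤ℤ_ (ℤ.pos-* g (suc (2 * n))) (ℤ.pos-* (count A n) (suc d))
                          (+≤+ g[2n+1]≤c[d+1])))

frequently-dense : ∀ A g m′ → g ≤ suc m′ → (∀ q → count A (q * suc m′) ≡ q * (g + g) + 1) →
                   ∀ N → ∃[ n ] (N ≤ n × frac g (suc m′) ℚ.≤ ratioAt A n)
frequently-dense A g m′ g≤m count≡ N =
  N * suc m′ , m≤m*n N (suc m′) , frac≤ratioAt g m′ A (N * suc m′) (subst₂ _≤_
    (sym (g[2qm+1]≡g+2gqm g N (suc m′)))
    (trans (m+2gqm≡[2gq+1]m g N (suc m′)) (cong (_* suc m′) (sym (count≡ N))))
    (+-monoˡ-≤ (N * (g + g) * suc m′) g≤m))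
  where
  g[2qm+1]≡g+2gqm : ∀ g q m → g * suc (2 * (q * m)) ≡ g + q * (g + g) * m
  g[2qm+1]≡g+2gqm g q m = solve (g ∷ q ∷ m ∷ [])
  m+2gqm≡[2gq+1]m : ∀ g q m → m + q * (g + g) * m ≡ (q * (g + g) + 1) * m
  m+2gqm≡[2gq+1]m g q m = solve (g ∷ q ∷ m ∷ [])

DfBothAtLeast-intro : ∀ {S A r} → FreeBoth S A →
                      (∀ N → ∃[ n ] (N ≤ n × r ℚ.≤ ratioAt A n)) → DfBothAtLeast S r
DfBothAtLeast-intro {A = A} {r} free often ε 0<ε = A , free , λ ε′ 0<ε′ N →
  let n , N≤n , r≤ratio = often N in
  n , N≤n , ℚ.<-≤-trans (ℚ.<-trans (p-q<p (r ℚ.- ε) 0<ε′) (p-q<p r 0<ε)) r≤ratio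

dfGeDfBoth : ∀ S → DfGeDfBoth S
dfGeDfBoth S r df≥r ε 0<ε =
  let A , (S-free , _) , dense = df≥r ε 0<ε in A , S-free , dense

≡ᵇ≡true⇒≡ : ∀ {m n} → (m ≡ᵇ n) ≡ true → m ≡ n
≡ᵇ≡true⇒≡ {m} {n} eq = ≡ᵇ⇒≡ m n (subst T (sym eq) _)

≡ᵇ≡false⇒≢ : ∀ {m n} → (m ≡ᵇ n) ≡ false → m ≢ n
≡ᵇ≡false⇒≢ {m} {n} eq m≡n = subst T eq (≡⇒≡ᵇ m n m≡n)

notTwoMod3 : ℕ → Bool
notTwoMod3 j = not (j % 3 ≡ᵇ 2)

sum<-notTwoMod3 : ∀ k → sum< (𝟙 ∘ notTwoMod3) (1 + k * 3) ≡ 1 + k * 2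
sum<-notTwoMod3 k = cong (_+_ 1) (sum<-periodic (𝟙 ∘ notTwoMod3 ∘ suc) 3 periodic k)
  where
  periodic : ∀ i → 𝟙 (notTwoMod3 (suc (3 + i))) ≡ 𝟙 (notTwoMod3 (suc i))
  periodic i = cong (λ r → 𝟙 (not (r ≡ᵇ 2))) (%-remove-+ˡ (suc i) {3} ∣-refl)

module Residue (m′ : ℕ) where

  m : ℕ
  m = suc m′

  res : ℤ → ℕ
  res (+ n)    = n % m
  res -[1+ n ] = m′ ∸ n % m

  res<m : ∀ x → res x < m
  res<m (+ n)    = m%n<n n m
  res<m -[1+ n ] = s≤s (m∸n≤m m′ (n % m))

  res-suc : ∀ x → res (sucℤ x) ≡ (1 + res x) % m
  res-suc (+ n)          = sym ([m+n%d]%d≡[m+n]%d 1 n m)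
  res-suc -[1+ zero ]    = sym (n%n≡0 m)
  res-suc -[1+ suc n ] with n % m ≟ m′
  ... | yes r≡m′ = begin
    m′ ∸ n % m                 ≡⟨ cong (m′ ∸_) r≡m′ ⟩
    m′ ∸ m′                    ≡⟨ n∸n≡0 m′ ⟩
    0                          ≡⟨ n%n≡0 m ⟨
    (1 + (m′ ∸ 0)) % m         ≡⟨ cong (λ s → (1 + (m′ ∸ s)) % m) [1+n]%m≡0 ⟨
    (1 + (m′ ∸ suc n % m)) % m ∎
    where
    [1+n]%m≡0 : suc n % m ≡ 0
    [1+n]%m≡0 = begin
      suc n % m          ≡⟨ [m+n%d]%d≡[m+n]%d 1 n m ⟨
      (1 + n % m) % m    ≡⟨ cong (λ s → (1 + s) % m) r≡m′ ⟩
      m % m              ≡⟨ n%n≡0 m ⟩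
      0                  ∎
  ... | no r≢m′ = begin
    m′ ∸ n % m                 ≡⟨ m<n⇒m%n≡m (s≤s (m∸n≤m m′ (n % m))) ⟨
    (m′ ∸ n % m) % m           ≡⟨ cong (_% m) (+-∸-assoc 1 r<m′) ⟩
    (1 + (m′ ∸ suc (n % m))) % m ≡⟨ cong (λ s → (1 + (m′ ∸ s)) % m) [1+n]%m≡1+r ⟨
    (1 + (m′ ∸ suc n % m)) % m ∎
    where
    r<m′ : suc (n % m) ≤ m′
    r<m′ = ≤∧≢⇒< (≤-pred (m%n<n n m)) r≢m′
    [1+n]%m≡1+r : suc n % m ≡ suc (n % m)
    [1+n]%m≡1+r = trans (sym ([m+n%d]%d≡[m+n]%d 1 n m)) (m<n⇒m%n≡m (s≤s r<m′))

  res-+ : ∀ k x → res (+ k +ℤ x) ≡ (k + res x) % m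
  res-+ zero    x = trans (cong res (ℤ.+-identityˡ x)) (sym (m<n⇒m%n≡m (res<m x)))
  res-+ (suc k) x = begin
    res (+ suc k +ℤ x)          ≡⟨ cong res (ℤ.+-assoc (+ 1) (+ k) x) ⟩
    res (sucℤ (+ k +ℤ x))       ≡⟨ res-suc (+ k +ℤ x) ⟩
    (1 + res (+ k +ℤ x)) % m    ≡⟨ cong (λ r → (1 + r) % m) (res-+ k x) ⟩
    (1 + (k + res x) % m) % m   ≡⟨ [m+n%d]%d≡[m+n]%d 1 (k + res x) m ⟩
    (suc k + res x) % m         ∎

  res-+m : ∀ x → res (+ m +ℤ x) ≡ res x
  res-+m x = begin
    res (+ m +ℤ x)     ≡⟨ res-+ m x ⟩
    (m + res x) % m    ≡⟨ %-remove-+ˡ (res x) ∣-refl ⟩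
    res x % m          ≡⟨ m<n⇒m%n≡m (res<m x) ⟩
    res x              ∎

  count-periodic : ∀ (B : ℕ → Bool) q →
    count (B ∘ res) (q * m) ≡ q * (sum< (𝟙 ∘ B) m + sum< (𝟙 ∘ B) m) + 𝟙 (B 0)
  count-periodic B q = begin
    count (B ∘ res) (q * m)   ≡⟨ count≡sum< (B ∘ res) (q * m) ⟩
    sum< h (q * m) + 𝟙 (B 0) ≡⟨ cong (_+ 𝟙 (B 0)) (sum<-periodic h m h-periodic q) ⟩
    q * sum< h m + 𝟙 (B 0)   ≡⟨ cong (λ s → q * s + 𝟙 (B 0)) (sum<-+ neg pos m) ⟩
    q * (sum< neg m + sum< pos m) + 𝟙 (B 0)
                              ≡⟨ cong₂ (λ s t → q * (s + t) + 𝟙 (B 0)) neg-period pos-period ⟩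
    q * (sum< (𝟙 ∘ B) m + sum< (𝟙 ∘ B) m) + 𝟙 (B 0) ∎
    where
    neg pos h : ℕ → ℕ
    neg i = 𝟙 (B (m′ ∸ i % m))
    pos i = 𝟙 (B (suc i % m))
    h i = neg i + pos i

    h-periodic : ∀ i → h (m + i) ≡ h i
    h-periodic i = cong₂ (λ r s → 𝟙 (B (m′ ∸ r)) + 𝟙 (B s))
      (%-remove-+ˡ i {m} ∣-refl) (trans (cong (_% m) (sym (+-suc m i))) (%-remove-+ˡ (suc i) {m} ∣-refl))

    neg-period : sum< neg m ≡ sum< (𝟙 ∘ B) m
    neg-period = trans
      (sum<-cong neg (λ i → 𝟙 (B (m′ ∸ i))) m (λ i<m → cong (λ r → 𝟙 (B (m′ ∸ r))) (m<n⇒m%n≡m i<m)))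
      (sum<-reverse (𝟙 ∘ B) m′)

    pos-period : sum< pos m ≡ sum< (𝟙 ∘ B) m
    pos-period = trans
      (sum<-rotate (λ i → 𝟙 (B (i % m))) m (cong (𝟙 ∘ B) (n%n≡0 m)))
      (sum<-cong (λ i → 𝟙 (B (i % m))) (𝟙 ∘ B) m (λ i<m → cong (𝟙 ∘ B) (m<n⇒m%n≡m i<m)))

  allowed : ℕ → Bool
  allowed j = not (j ≡ᵇ m′) ∧ notTwoMod3 j

  allowed⇒ : ∀ {j} → allowed j ≡ true → j ≢ m′ × j % 3 ≢ 2
  allowed⇒ {j} aj with j ≡ᵇ m′ in j=m′ | j % 3 ≡ᵇ 2 in j%3=2
  allowed⇒ {j} () | true  | _
  allowed⇒ {j} () | false | true
  allowed⇒ {j} _  | false | false = ≡ᵇ≡false⇒≢ j=m′ , ≡ᵇ≡false⇒≢ j%3=2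

  allowed-below : ∀ {j} → j < m′ → allowed j ≡ notTwoMod3 j
  allowed-below {j} j<m′ with j ≡ᵇ m′ in j=m′
  ... | true  = contradiction (≡ᵇ≡true⇒≡ j=m′) (<⇒≢ j<m′)
  ... | false = refl

  allowed-m′ : allowed m′ ≡ false
  allowed-m′ with m′ ≡ᵇ m′ in m′=m′
  ... | true  = refl
  ... | false = contradiction refl (≡ᵇ≡false⇒≢ {m′} m′=m′)

  next : ℕ → ℕ
  next j = (1 + j) % m

  no-allowed-run : ∀ {j} → j < m → allowed j ≡ true → allowed (next j) ≡ true →
                   allowed (next (next j)) ≡ true → ⊥
  no-allowed-run {j} j<m a₀ a₁ a₂ =
    [ proj₂ (allowed⇒ {j} a₀)
    , [ proj₂ (allowed⇒ {suc j} a₁′) , proj₂ (allowed⇒ {suc (suc j)} a₂′) ]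
    ] (%3≡2-among-three j)
    where
    next≡suc : ∀ {i} → i < m → i ≢ m′ → next i ≡ suc i
    next≡suc i<m i≢m′ = m<n⇒m%n≡m (s≤s (≤∧≢⇒< (≤-pred i<m) i≢m′))
    e₁ : next j ≡ suc j
    e₁ = next≡suc j<m (proj₁ (allowed⇒ a₀))
    a₁′ : allowed (suc j) ≡ true
    a₁′ = subst (λ i → allowed i ≡ true) e₁ a₁
    e₂ : next (next j) ≡ suc (suc j)
    e₂ = trans (cong next e₁) (next≡suc (subst (_< m) e₁ (m%n<n (1 + j) m)) (proj₁ (allowed⇒ a₁′)))
    a₂′ : allowed (suc (suc j)) ≡ true
    a₂′ = subst (λ i → allowed i ≡ true) e₂ a₂

  sum<-allowed : m % 3 ≡ 2 → sum< (𝟙 ∘ allowed) m ≡ (2 * m) / 3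
  sum<-allowed m%3≡2 = begin
    sum< (𝟙 ∘ allowed) (suc m′)              ≡⟨ sum<-snoc (𝟙 ∘ allowed) m′ ⟩
    sum< (𝟙 ∘ allowed) m′ + 𝟙 (allowed m′)   ≡⟨ cong₂ _+_ (sum<-cong _ _ m′ (cong 𝟙 ∘ allowed-below))
                                                          (cong 𝟙 allowed-m′) ⟩
    sum< (𝟙 ∘ notTwoMod3) m′ + 0             ≡⟨ +-identityʳ _ ⟩
    sum< (𝟙 ∘ notTwoMod3) m′                 ≡⟨ cong (sum< (𝟙 ∘ notTwoMod3)) (suc-injective m≡2+3k) ⟩
    sum< (𝟙 ∘ notTwoMod3) (1 + k * 3)        ≡⟨ sum<-notTwoMod3 k ⟩
    1 + k * 2                                ≡⟨ m*n/n≡m (1 + k * 2) 3 ⟨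
    (1 + k * 2) * 3 / 3                      ≡⟨ +-distrib-/-∣ʳ 1 {d = 3} (divides-refl (1 + k * 2)) ⟨
    (1 + (1 + k * 2) * 3) / 3                ≡⟨ cong (_/ 3) (2[2+3k]≡1+[1+2k]3 k) ⟨
    (2 * (2 + k * 3)) / 3                    ≡⟨ cong (λ n → (2 * n) / 3) m≡2+3k ⟨
    (2 * m) / 3                              ∎
    where
    k : ℕ
    k = m / 3
    m≡2+3k : m ≡ 2 + k * 3
    m≡2+3k = trans (m≡m%n+[m/n]*n m 3) (cong (_+ k * 3) m%3≡2)
    2[2+3k]≡1+[1+2k]3 : ∀ k → 2 * (2 + k * 3) ≡ 1 + (1 + k * 2) * 3
    2[2+3k]≡1+[1+2k]3 k = solve (k ∷ [])

module Construction (m′ a b u : ℕ) (a+[a+b]≡m : a + (a + b) ≡ suc m′)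
                    (ua≡1 : (u * a) % suc m′ ≡ 1 % suc m′) where
  open Residue m′

  ψ : ℤ → ℕ
  ψ x = (u * res x) % m

  A : SetZ
  A x = allowed (ψ x)

  ψ-+a : ∀ x → ψ (+ a +ℤ x) ≡ next (ψ x)
  ψ-+a x = begin
    (u * res (+ a +ℤ x)) % m    ≡⟨ cong (λ r → (u * r) % m) (res-+ a x) ⟩
    (u * ((a + res x) % m)) % m ≡⟨ [m*[n%d]]%d≡[m*n]%d u (a + res x) m ⟩
    (u * (a + res x)) % m       ≡⟨ cong (_% m) (*-distribˡ-+ u a (res x)) ⟩
    (u * a + u * res x) % m     ≡⟨ %-congˡ-+ {u * a} {1} (u * res x) m ua≡1 ⟩
    (1 + u * res x) % m         ≡⟨ [m+n%d]%d≡[m+n]%d 1 (u * res x) m ⟨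
    next (ψ x)                  ∎

  A-periodic : ∀ x → A (+ (a + (a + b)) +ℤ x) ≡ A x
  A-periodic x = trans (cong (λ n → A (+ n +ℤ x)) a+[a+b]≡m)
                       (cong (λ r → allowed ((u * r) % m)) (res-+m x))

  no-progression : ∀ x → A x ≡ true → A (+ a +ℤ x) ≡ true → A (+ a +ℤ (+ a +ℤ x)) ≡ true → ⊥
  no-progression x p₀ p₁ p₂ = no-allowed-run (m%n<n (u * res x) m) p₀
    (subst (λ j → allowed j ≡ true) (ψ-+a x) p₁)
    (subst (λ j → allowed j ≡ true) (trans (ψ-+a (+ a +ℤ x)) (cong next (ψ-+a x))) p₂)

  S : List ℤ
  S = + 0 ∷ + a ∷ + (a + b) ∷ []

  A-S-free : Free S A
  A-S-free t (p₀ All.∷ pₐ All.∷ pₐ₊ᵦ All.∷ All.[]) = no-progression (+ (a + b) +ℤ t) pₐ₊ᵦ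
    (trans (cong A (I₁ (+ a) (+ b) t))
      (trans (A-periodic t) (trans (cong A (sym (ℤ.+-identityˡ t))) p₀)))
    (trans (cong A (I₂ (+ a) (+ b) t)) (trans (A-periodic (+ a +ℤ t)) pₐ))
    where
    I₁ : ∀ α β t → α +ℤ ((α +ℤ β) +ℤ t) ≡ (α +ℤ (α +ℤ β)) +ℤ t
    I₁ = solve-∀
    I₂ : ∀ α β t → α +ℤ (α +ℤ ((α +ℤ β) +ℤ t)) ≡ (α +ℤ (α +ℤ β)) +ℤ (α +ℤ t)
    I₂ = solve-∀

  A-negS-free : Free (negS S) A
  A-negS-free t (p₀ All.∷ pₐ All.∷ pₐ₊ᵦ All.∷ All.[]) = no-progression (- + a +ℤ t) pₐ
    (trans (cong A (I₃ (+ a) t)) (trans (cong A (sym (ℤ.+-identityˡ t))) p₀))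
    (trans (cong A (I₄ (+ a) (+ b) t)) (trans (A-periodic (- + (a + b) +ℤ t)) pₐ₊ᵦ))
    where
    I₃ : ∀ α t → α +ℤ (- α +ℤ t) ≡ t
    I₃ = solve-∀
    I₄ : ∀ α β t → α +ℤ (α +ℤ (- α +ℤ t)) ≡ (α +ℤ (α +ℤ β)) +ℤ (- (α +ℤ β) +ℤ t)
    I₄ = solve-∀

  count-A : 0 < m′ → ∀ q → count A (q * m) ≡ q * (sum< (𝟙 ∘ allowed) m + sum< (𝟙 ∘ allowed) m) + 1
  count-A 0<m′ q = begin
    count A (q * m)                                      ≡⟨ count-periodic B q ⟩
    q * (sum< (𝟙 ∘ B) m + sum< (𝟙 ∘ B) m) + 𝟙 (B 0)     ≡⟨ cong₂ (λ s t → q * (s + s) + 𝟙 t) permuted B0 ⟩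
    q * (sum< (𝟙 ∘ allowed) m + sum< (𝟙 ∘ allowed) m) + 1 ∎
    where
    B : ℕ → Bool
    B j = allowed ((u * j) % m)
    inverse : ∀ v w → (v * w) % m ≡ 1 % m → ∀ {i} → i < m → (v * ((w * i) % m)) % m ≡ i
    inverse v w vw≡1 {i} i<m = trans (*-inverse-% {v} {w} i m vw≡1) (m<n⇒m%n≡m i<m)
    au≡1 : (a * u) % m ≡ 1 % m
    au≡1 = trans (cong (_% m) (*-comm a u)) ua≡1
    permuted : sum< (𝟙 ∘ B) m ≡ sum< (𝟙 ∘ allowed) m
    permuted = sum<-permute m (λ j → (u * j) % m) (λ j → (a * j) % m)
      (λ {j} _ → m%n<n (u * j) m) (λ {j} _ → m%n<n (a * j) m)
      (inverse u a ua≡1) (inverse a u au≡1) (𝟙 ∘ allowed)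
    B0 : B 0 ≡ true
    B0 = trans (cong (λ j → allowed (j % m)) (*-zeroʳ u)) (allowed-below 0<m′)

proposition2 : (λ₁ λ₂ : ℕ) → 0 < λ₁ → 0 < λ₂ → Coprime λ₁ λ₂ →
    λ₁ % 3 ≡ (λ₂ + 1) % 3 →
    let S = + 0 ∷ + λ₁ ∷ + (λ₁ + λ₂) ∷ []
        m = 2 * λ₁ + λ₂
    in DfGeDfBoth S × DfBothAtLeast S (frac ((2 * m) / 3) m)
proposition2 (suc a′) b _ _ a⊥b a≡b+1 =
  dfGeDfBoth S ,
  DfBothAtLeast-intro (A-S-free , A-negS-free)
    (subst (λ g → ∀ N → ∃[ n ] (N ≤ n × frac g m ℚ.≤ ratioAt A n))
      (sum<-allowed ([2a+b]%3≡2 a b a≡b+1))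
      (frequently-dense A _ m′ (sum<-𝟙≤ allowed m) (count-A 0<m′)))
  where
  a m′ : ℕ
  a = suc a′
  m′ = pred (2 * a + b)
  0<m′ : 0 < m′
  0<m′ = ≤-trans (s≤s z≤n) (≤-trans (m≤n+m (suc a′ + 0) a′) (m≤m+n _ b))
  a⊥m : Coprime a (suc m′)
  a⊥m = subst (Coprime a) (sym (2a+b≡a+[a+b] a b))
          (Coprime.sym (coprime-+ (coprime-+ (Coprime.sym a⊥b))))
  open Residue m′ using (m; allowed; sum<-allowed)
  open Construction m′ a b (proj₁ (inverse-mod a m′ a⊥m)) (sym (2a+b≡a+[a+b] a b))
                           (proj₂ (inverse-mod a m′ a⊥m))
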